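{- Let $R$ be a finite set of positive integers. If $\alpha$ is a jump for $R$ and there exists an $R$-graph $F$ with $\lambda(F)=\alpha$, then $\alpha$ is a weak jump for $R$.
   Context: A hypergraph is a pair $(V,E)$ with $E\subseteq 2^V$; it is an $R$-graph if all edge sizes lie in $R$. For an $R$-graph $H$ on $n$ vertices, $h_n(H)=\sum_{e\in E(H)}1/\binom{n}{|e|}$. For a hypergraph $F$ on $[m]$, $\lambda(F,\vec x)=\sum_{e\in E(F)}|e|!\prod_{i\in e}x_i$ and $\lambda(F)=\max\{\lambda(F,\vec x):\vec x\in[0,1]^m,\sum x_i=1\}$. A value $\alpha$ is a jump for $R$ if there exists $c>0$ such that for every $\epsilon>0$ and every integer $t\ge\max R$ there is $n_0$ such that whenever $n\ge n_0$ and $G_n$ is an $R$-graph on $n$ vertices with $h_n(G_n)\ge\alpha+\epsilon$, $G_n$ contains a subgraph $H_t$ on $t$ vertices with $h_t(H_t)\ge\alpha+c$. It is a strong jump if there exists $c>0$ such that for every integer $t\ge\max R$ there is $n_0$ such that whenever $n\ge n_0$ and $G_n$ is an $R$-graph on $n$ vertices with $h_n(G_n)\ge\alpha-c$, $G_n$ contains a subgraph on $t$ vertices with $h_t\ge\alpha+c$. A weak jump is a jump that is not a strong jump.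
   Formalization: The constants c and ε in the definitions of jump and strong jump are positive rationals, and λ(F) is taken as the supremum of $\lambda(F,\vec x)$ over rational points of the simplex. -}

module Defs where

open import Data.Bool using (Bool; true; false; T)
open import Data.Nat using (ℕ; zero; suc; _≤_; _!; _⊔_)
open import Data.Nat.Combinatorics using (_C_)
open import Data.Integer using (+_)
import Data.Fin as Fin
open Fin using (Fin)
import Data.Rational.Unnormalised
open import Relation.Binary.PropositionalEquality using (_≡_)
open import Data.Fin.Subset using (Subset; Side; inside; outside; _⊆_) renaming (∣_∣ to card)
open import Data.Vec using (Vec; []; _∷_; lookup)
open import Data.List using (List; []; _∷_; _++_; map; foldr)
open import Data.List.Membership.Propositional using (_∈_)
open import Data.Product using (Σ; ∃; _×_; _,_)
open import Relation.Nullary using (¬_)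
open import Data.Rational.Unnormalised
  using (ℚᵘ; mkℚᵘ; 0ℚᵘ; 1ℚᵘ; _+_; _*_; _-_; _<_)
  renaming (_≤_ to _≤q_)

ℕ→ℚ : ℕ → ℚᵘ
ℕ→ℚ k = mkℚᵘ (+ k) 0

-- 1 / k for k ≥ 1  (mkℚᵘ p d denotes p / (suc d)); only used with k ≥ 1.
inv : ℕ → ℚᵘ
inv zero    = 0ℚᵘ
inv (suc k) = mkℚᵘ (+ 1) k

allSubsets : (n : ℕ) → List (Subset n)
allSubsets zero    = [] ∷ []
allSubsets (suc n) = map (inside ∷_) (allSubsets n) ++ map (outside ∷_) (allSubsets n)

sumℚ : List ℚᵘ → ℚᵘ
sumℚ = foldr _+_ 0ℚᵘ

Hypergraph : ℕ → Set
Hypergraph n = Subset n → Bool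

IsRGraph : List ℕ → {n : ℕ} → Hypergraph n → Set
IsRGraph R {n} G = (e : Subset n) → T (G e) → card e ∈ R

edgeTerm : Bool → ℚᵘ → ℚᵘ
edgeTerm true  q = q
edgeTerm false q = 0ℚᵘ

sumEdges : {n : ℕ} → Hypergraph n → (Subset n → ℚᵘ) → ℚᵘ
sumEdges {n} G f = sumℚ (map (λ e → edgeTerm (G e) (f e)) (allSubsets n))

h : (n : ℕ) → Hypergraph n → ℚᵘ
h n G = sumEdges G (λ e → inv (n C card e))

edgeIn : {n : ℕ} → Hypergraph n → Subset n → Hypergraph n
edgeIn G S e with G e
... | false = false
... | true  = isSub S e
  where
  isSub : {k : ℕ} → Subset k → Subset k → Bool
  isSub []            []            = true
  isSub (_ ∷ s)       (outside ∷ x) = isSub s x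
  isSub (inside ∷ s)  (inside ∷ x)  = isSub s x
  isSub (outside ∷ s) (inside ∷ x)  = false

hSub : {n : ℕ} → (t : ℕ) → Hypergraph n → Subset n → ℚᵘ
hSub t G S = sumEdges (edgeIn G S) (λ e → inv (t C card e))

prodOn : {m : ℕ} → Subset m → (Fin m → ℚᵘ) → ℚᵘ
prodOn [] x = 1ℚᵘ
prodOn (inside ∷ e)  x = x Fin.zero * prodOn e (λ i → x (Fin.suc i))
prodOn (outside ∷ e) x = prodOn e (λ i → x (Fin.suc i))

lagPoly : {m : ℕ} → Hypergraph m → (Fin m → ℚᵘ) → ℚᵘ
lagPoly F x = sumEdges F (λ e → ℕ→ℚ (card e !) * prodOn e x)

sumFin : (m : ℕ) → (Fin m → ℚᵘ) → ℚᵘ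
sumFin zero    x = 0ℚᵘ
sumFin (suc m) x = x Fin.zero + sumFin m (λ i → x (Fin.suc i))

InSimplex : {m : ℕ} → (Fin m → ℚᵘ) → Set
InSimplex {m} x = ((i : Fin m) → 0ℚᵘ ≤q x i) × (sumFin m x Data.Rational.Unnormalised.≃ 1ℚᵘ)

-- "q ≥ λ(F) + r", where λ(F) = max over the simplex of λ(F, x).
-- Since λ(F,·) is continuous and rational points are dense in the simplex,
-- this holds iff λ(F, x) + r ≤ q for all rational x in the simplex.
LagPlusLe : {m : ℕ} → Hypergraph m → ℚᵘ → ℚᵘ → Set
LagPlusLe {m} F r q = (x : Fin m → ℚᵘ) → InSimplex x → lagPoly F x + r ≤q q

maxR : List ℕ → ℕ
maxR = foldr _⊔_ 0

-- G (on n vertices) contains a subgraph on t vertices with h_t ≥ λ(F) + c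
-- (WLOG induced, on a t-subset S of the vertices).
HasDenseSub : {m n : ℕ} → Hypergraph m → ℚᵘ → (t : ℕ) → Hypergraph n → Set
HasDenseSub F c t G = Σ _ λ S → (card S ≡ t) × LagPlusLe F c (hSub t G S)

IsJump : List ℕ → {m : ℕ} → Hypergraph m → Set
IsJump R F =
  Σ ℚᵘ λ c → (0ℚᵘ < c) ×
    ((ε : ℚᵘ) → 0ℚᵘ < ε → (t : ℕ) → maxR R ≤ t →
      Σ ℕ λ n₀ → (n : ℕ) → n₀ ≤ n → (G : Hypergraph n) → IsRGraph R G →
        LagPlusLe F ε (h n G) → HasDenseSub F c t G)

IsStrongJump : List ℕ → {m : ℕ} → Hypergraph m → Set
IsStrongJump R F =
  Σ ℚᵘ λ c → (0ℚᵘ < c) ×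
    ((t : ℕ) → maxR R ≤ t →
      Σ ℕ λ n₀ → (n : ℕ) → n₀ ≤ n → (G : Hypergraph n) → IsRGraph R G →
        LagPlusLe F (0ℚᵘ - c) (h n G) → HasDenseSub F c t G)

IsWeakJump : List ℕ → {m : ℕ} → Hypergraph m → Set
IsWeakJump R F = IsJump R F × ¬ IsStrongJump R F

{-# OPTIONS --safe #-}
module Submission where

-- Only ¬ IsStrongJump needs proof. A labelling π : [n] → V(F) defines the blow-up F(π), whose
-- edges are the sets mapped injectively onto edges of F. If a t-set S has label counts s, then
-- h_t(F(π)[S]) = Σ_{f ∈ F} Π_{i ∈ f} s_i / C(t, |f|), which is at most λ(F, s/t) + E/t once t is
-- large, and at least λ(F, s/t) when S is the whole vertex set.
-- Suppose λ(F) were a strong jump with constant c and take t with E/t < c: then no blow-up of F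
-- has a t-set of density λ(F) + c. But for large n, the blow-up along the grid point k/n that
-- maximises λ(F, ·) has h_n ≥ λ(F, k/n) ≥ λ(F) − L/n ≥ λ(F) − c, because λ(F, ·) is L-Lipschitz
-- and every point of the simplex lies within 1/n of the grid.

open import Defs

open import Data.Bool using (Bool; true; false; T; _∧_)
open import Data.Bool.Properties using (∧-identityʳ)
open import Data.Empty using (⊥-elim)
open import Data.Fin using (Fin; zero; suc)
open import Data.Fin.Subset using (Subset; inside; outside; ⊤) renaming (∣_∣ to card)
open import Data.Integer as ℤ using (+_; -[1+_]; +[1+_]; +0)
import Data.Integer.Properties as ℤₚ
open import Data.List using (List; []; _∷_; _++_; map)
open import Data.List.Membership.Propositional using (_∈_)
open import Data.List.Properties using (map-cong)
open import Data.List.Relation.Unary.All using (All)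
open import Data.List.Relation.Unary.Any using (here; there)
open import Data.Maybe as Maybe using (Maybe; just; nothing; maybe′)
open import Data.Maybe.Properties using (map-nothing)
open import Data.Nat as ℕ using (ℕ; zero; suc; s≤s; z≤n; _!; _^_; _∸_; _⊔_)
open import Data.Nat.Combinatorics using (_C_)
open import Data.Nat.DivMod using (_/_; m/n*n≤m; m≡m%n+[m/n]*n; m%n<n)
import Data.Nat.Properties as ℕₚ
open import Data.Product using (Σ; _×_; _,_; proj₁; proj₂)
open import Data.Sum using (inj₁; inj₂)
open import Data.Vec as Vec using (Vec; []; _∷_; lookup; tabulate; updateAt; replicate; sum)
open import Data.Vec.Properties using (lookup∘tabulate; tabulate∘lookup)
open import Relation.Binary.PropositionalEquality using (_≡_; refl; sym; trans; cong; cong₂; subst; subst₂)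
open import Relation.Nullary using (¬_)

-- Falling factorials

module _ where
  open import Data.Nat
  open import Data.Nat.Properties
  open import Data.Nat.Combinatorics using (_C_; nCk≡nPk/k!)
  open import Data.Nat.Combinatorics.Base using (_P′_; _P_)
  open import Data.Nat.Combinatorics.Specification using (k!∣nP′k)
  open import Data.Nat.DivMod using (m/n*n≡m)
  open import Data.Nat.Divisibility using (_∣_)
  open import Data.Nat.Tactic.RingSolver using (solve-∀)

  nP′k≡nPk : ∀ {n k} → k ≤ n → n P′ k ≡ n P k
  nP′k≡nPk {n} {k} k≤n with k ≤ᵇ n | ≤⇒≤ᵇ k≤n
  ... | true | _ = refl

  nCk*k!≡nP′k : ∀ {n k} → k ≤ n → (n C k) * k ! ≡ n P′ k
  nCk*k!≡nP′k {n} {k} k≤n = begin-equality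
    (n C k) * k !           ≡⟨ cong (_* k !) (nCk≡nPk/k! k≤n) ⟩
    ((n P k) / k !) * k !   ≡⟨ m/n*n≡m (subst (k ! ∣_) (nP′k≡nPk k≤n) (k!∣nP′k k≤n)) ⟩
    n P k                   ≡⟨ sym (nP′k≡nPk k≤n) ⟩
    n P′ k                  ∎
    where
    open ≤-Reasoning
    instance _ = k !≢0

  nP′k>0 : ∀ {n k} → k ≤ n → n P′ k > 0
  nP′k>0 {n} {zero}  _   = s≤s z≤n
  nP′k>0 {n} {suc k} k<n = *-mono-≤ (m<n⇒0<n∸m k<n) (nP′k>0 (<⇒≤ k<n))

  nCk>0 : ∀ {n k} → k ≤ n → n C k > 0
  nCk>0 {n} {k} k≤n with n C k | nCk*k!≡nP′k k≤n
  ... | suc _ | _      = s≤s z≤n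
  ... | zero  | 0≡nP′k = subst (_> 0) (sym 0≡nP′k) (nP′k>0 k≤n)

  nP′k≤n^k : ∀ n k → n P′ k ≤ n ^ k
  nP′k≤n^k n zero    = ≤-refl
  nP′k≤n^k n (suc k) = *-mono-≤ (m∸n≤m n k) (nP′k≤n^k n k)

  -- n^k − n(n−1)⋯(n−k+1) ≤ k² n^(k−1), multiplied by n to avoid k − 1.
  n^k*n≤nP′k*n+k*k*n^k : ∀ n k → n ^ k * n ≤ (n P′ k) * n + k * k * n ^ k
  n^k*n≤nP′k*n+k*k*n^k n zero    = ≤-reflexive (sym (+-identityʳ _))
  n^k*n≤nP′k*n+k*k*n^k n (suc k) = begin
    n * Q * n                                  ≡⟨ *-assoc n Q n ⟩
    n * (Q * n)                                ≤⟨ *-monoʳ-≤ n (n^k*n≤nP′k*n+k*k*n^k n k) ⟩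
    n * (F * n + k * k * Q)                    ≡⟨ distribute n F Q k ⟩
    n * F * n + k * k * (n * Q)                ≤⟨ +-monoˡ-≤ _ (*-monoˡ-≤ n (*-monoˡ-≤ F (m≤n+m∸n n k))) ⟩
    (k + (n ∸ k)) * F * n + k * k * (n * Q)    ≡⟨ split k (n ∸ k) F n Q ⟩
    (n ∸ k) * F * n + k * (F * n) + k * k * (n * Q)
      ≤⟨ +-monoˡ-≤ _ (+-monoʳ-≤ ((n ∸ k) * F * n) (*-monoʳ-≤ k (*-monoˡ-≤ n (nP′k≤n^k n k)))) ⟩
    (n ∸ k) * F * n + k * (Q * n) + k * k * (n * Q)  ≡⟨ collect ((n ∸ k) * F * n) k n Q ⟩
    (n ∸ k) * F * n + (k * k + k) * (n * Q)    ≤⟨ +-monoʳ-≤ ((n ∸ k) * F * n) (*-monoˡ-≤ (n * Q) k*k+k≤[1+k]*[1+k]) ⟩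
    (n ∸ k) * F * n + suc k * suc k * (n * Q)  ∎
    where
    open ≤-Reasoning
    F = n P′ k
    Q = n ^ k
    distribute : ∀ n F Q k → n * (F * n + k * k * Q) ≡ n * F * n + k * k * (n * Q)
    distribute = solve-∀
    split : ∀ k d F n Q → (k + d) * F * n + k * k * (n * Q) ≡ d * F * n + k * (F * n) + k * k * (n * Q)
    split = solve-∀
    collect : ∀ x k n Q → x + k * (Q * n) + k * k * (n * Q) ≡ x + (k * k + k) * (n * Q)
    collect = solve-∀
    k*k+k≤[1+k]*[1+k] : k * k + k ≤ suc k * suc k
    k*k+k≤[1+k]*[1+k] = ≤-trans (m≤m+n (k * k + k) (suc k)) (≤-reflexive (square k))
      where
      square : ∀ k → k * k + k + suc k ≡ suc k * suc k
      square = solve-∀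

  n^k≤2*nP′k : ∀ {n} k → 0 < n → 2 * k * k ≤ n → n ^ k ≤ 2 * (n P′ k)
  n^k≤2*nP′k {n@(suc _)} k _ 2k²≤n = *-cancelʳ-≤ (n ^ k) (2 * F) n (+-cancelʳ-≤ (Q * n) (Q * n) (2 * F * n) (begin
    Q * n + Q * n                 ≡⟨ double Q n ⟩
    2 * (Q * n)                   ≤⟨ *-monoʳ-≤ 2 (n^k*n≤nP′k*n+k*k*n^k n k) ⟩
    2 * (F * n + k * k * Q)       ≡⟨ expand F n k Q ⟩
    2 * F * n + 2 * k * k * Q     ≤⟨ +-monoʳ-≤ (2 * F * n) (*-monoˡ-≤ Q 2k²≤n) ⟩
    2 * F * n + n * Q             ≡⟨ cong (λ x → 2 * F * n + x) (*-comm n Q) ⟩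
    2 * F * n + Q * n             ∎))
    where
    open ≤-Reasoning
    F = n P′ k
    Q = n ^ k
    double : ∀ Q n → Q * n + Q * n ≡ 2 * (Q * n)
    double = solve-∀
    expand : ∀ F n k Q → 2 * (F * n + k * k * Q) ≡ 2 * F * n + 2 * k * k * Q
    expand = solve-∀

  k!*p*nCk≤p*n^k : ∀ {n k} p → k ≤ n → k ! * p * (n C k) ≤ p * n ^ k
  k!*p*nCk≤p*n^k {n} {k} p k≤n = begin
    k ! * p * (n C k)     ≡⟨ rearrange (k !) p (n C k) ⟩
    p * ((n C k) * k !)   ≡⟨ cong (p *_) (nCk*k!≡nP′k k≤n) ⟩
    p * (n P′ k)          ≤⟨ *-monoʳ-≤ p (nP′k≤n^k n k) ⟩
    p * n ^ k             ∎
    where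
    open ≤-Reasoning
    rearrange : ∀ a p c → a * p * c ≡ p * (c * a)
    rearrange = solve-∀

  p*n^k*n≤[k!*p*n+2*k!*k*k*n^k]*nCk : ∀ {n k p} → 0 < n → k ≤ n → 2 * k * k ≤ n → p ≤ n ^ k →
    p * (n ^ k * n) ≤ (k ! * p * n + 2 * k ! * k * k * n ^ k) * (n C k)
  p*n^k*n≤[k!*p*n+2*k!*k*k*n^k]*nCk {n} {k} {p} 0<n k≤n 2k²≤n p≤n^k = begin
    p * (Q * n)                           ≤⟨ *-monoʳ-≤ p (n^k*n≤nP′k*n+k*k*n^k n k) ⟩
    p * (F * n + k * k * Q)               ≡⟨ distribute p F n k Q ⟩
    p * F * n + p * (k * k * Q)
      ≤⟨ +-monoʳ-≤ (p * F * n) (*-monoˡ-≤ (k * k * Q) (≤-trans p≤n^k (n^k≤2*nP′k k 0<n 2k²≤n))) ⟩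
    p * F * n + 2 * F * (k * k * Q)
      ≡⟨ cong (λ x → p * x * n + 2 * x * (k * k * Q)) (sym (nCk*k!≡nP′k k≤n)) ⟩
    p * (c * k !) * n + 2 * (c * k !) * (k * k * Q) ≡⟨ factor p (k !) c n k Q ⟩
    (k ! * p * n + 2 * k ! * k * k * Q) * c ∎
    where
    open ≤-Reasoning
    F = n P′ k
    Q = n ^ k
    c = n C k
    distribute : ∀ p F n k Q → p * (F * n + k * k * Q) ≡ p * F * n + p * (k * k * Q)
    distribute = solve-∀
    factor : ∀ p a c n k Q → p * (c * a) * n + 2 * (c * a) * (k * k * Q) ≡ (a * p * n + 2 * a * k * k * Q) * c
    factor = solve-∀

open import Data.Rational.Unnormalised
  using (ℚᵘ; mkℚᵘ; ↥_; _≃_; _+_; _*_; _-_; -_; _≤_; _<_; 0ℚᵘ; 1ℚᵘ; *≡*; *≤*; *<*; nonNegative)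
open import Data.Rational.Unnormalised.Properties
open import Tactic.RingSolver using (solve-∀)
open import Tactic.RingSolver.Core.AlmostCommutativeRing using (AlmostCommutativeRing; fromCommutativeRing)

ℚᵘ-ring : AlmostCommutativeRing _ _
ℚᵘ-ring = fromCommutativeRing +-*-commutativeRing (λ _ → nothing)

module _ {A : Set} where

  sumℚ-map-cong : ∀ {f g : A → ℚᵘ} xs → (∀ x → f x ≃ g x) → sumℚ (map f xs) ≃ sumℚ (map g xs)
  sumℚ-map-cong []       f≃g = ≃-refl
  sumℚ-map-cong (x ∷ xs) f≃g = +-cong (f≃g x) (sumℚ-map-cong xs f≃g)

  sumℚ-map-mono : ∀ {f g : A → ℚᵘ} xs → (∀ x → f x ≤ g x) → sumℚ (map f xs) ≤ sumℚ (map g xs)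
  sumℚ-map-mono []       f≤g = ≤-refl
  sumℚ-map-mono (x ∷ xs) f≤g = +-mono-≤ (f≤g x) (sumℚ-map-mono xs f≤g)

  sumℚ-map-zero : ∀ {f : A → ℚᵘ} xs → (∀ x → f x ≃ 0ℚᵘ) → sumℚ (map f xs) ≃ 0ℚᵘ
  sumℚ-map-zero []       f≃0 = ≃-refl
  sumℚ-map-zero (x ∷ xs) f≃0 = ≃-trans (+-cong (f≃0 x) (sumℚ-map-zero xs f≃0)) (+-identityˡ 0ℚᵘ)

  sumℚ-map-+ : ∀ (f g : A → ℚᵘ) xs →
    sumℚ (map (λ x → f x + g x) xs) ≃ sumℚ (map f xs) + sumℚ (map g xs)
  sumℚ-map-+ f g []       = ≃-sym (+-identityˡ 0ℚᵘ)
  sumℚ-map-+ f g (x ∷ xs) =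
    ≃-trans (+-congʳ (f x + g x) (sumℚ-map-+ f g xs)) (+-interchange (f x) (g x) _ _)
    where
    +-interchange : ∀ a b c d → (a + b) + (c + d) ≃ (a + c) + (b + d)
    +-interchange = solve-∀ ℚᵘ-ring

  sumℚ-map-*ʳ : ∀ (f : A → ℚᵘ) a xs → sumℚ (map (λ x → f x * a) xs) ≃ sumℚ (map f xs) * a
  sumℚ-map-*ʳ f a []       = ≃-sym (*-zeroˡ a)
  sumℚ-map-*ʳ f a (x ∷ xs) =
    ≃-trans (+-congʳ (f x * a) (sumℚ-map-*ʳ f a xs)) (≃-sym (*-distribʳ-+ a (f x) _))

  sumℚ-map-++ : ∀ (f : A → ℚᵘ) xs ys → sumℚ (map f (xs ++ ys)) ≃ sumℚ (map f xs) + sumℚ (map f ys)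
  sumℚ-map-++ f []       ys = ≃-sym (+-identityˡ _)
  sumℚ-map-++ f (x ∷ xs) ys = ≃-trans (+-congʳ (f x) (sumℚ-map-++ f xs ys)) (≃-sym (+-assoc (f x) _ _))

sumℚ-map-map : ∀ {A B : Set} (f : B → ℚᵘ) (g : A → B) xs → sumℚ (map f (map g xs)) ≡ sumℚ (map (λ x → f (g x)) xs)
sumℚ-map-map f g []       = refl
sumℚ-map-map f g (x ∷ xs) = cong (λ s → f (g x) + s) (sumℚ-map-map f g xs)

sumSubsets : (n : ℕ) → (Subset n → ℚᵘ) → ℚᵘ
sumSubsets n f = sumℚ (map f (allSubsets n))

sumSubsets-suc : ∀ n (f : Subset (suc n) → ℚᵘ) →
  sumSubsets (suc n) f ≃ sumSubsets n (λ e → f (inside ∷ e)) + sumSubsets n (λ e → f (outside ∷ e))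
sumSubsets-suc n f =
  ≃-trans (sumℚ-map-++ f (map (inside ∷_) (allSubsets n)) (map (outside ∷_) (allSubsets n)))
          (≃-reflexive (cong₂ _+_ (sumℚ-map-map f (inside ∷_) (allSubsets n))
                                  (sumℚ-map-map f (outside ∷_) (allSubsets n))))

edgeTerm-≤ : ∀ b {p q} → (T b → p ≤ q) → edgeTerm b p ≤ edgeTerm b q
edgeTerm-≤ true  p≤q = p≤q _
edgeTerm-≤ false p≤q = ≤-refl

edgeTerm-+ : ∀ b p q → edgeTerm b (p + q) ≃ edgeTerm b p + edgeTerm b q
edgeTerm-+ true  p q = ≃-refl
edgeTerm-+ false p q = ≃-sym (+-identityˡ 0ℚᵘ)

edgeTerm-*ʳ : ∀ b p q → edgeTerm b (p * q) ≃ edgeTerm b p * q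
edgeTerm-*ʳ true  p q = ≃-refl
edgeTerm-*ʳ false p q = ≃-sym (*-zeroˡ q)

edgeTerm-∧ : ∀ b c q → edgeTerm (b ∧ c) q ≡ edgeTerm c (edgeTerm b q)
edgeTerm-∧ true  c     q = refl
edgeTerm-∧ false true  q = refl
edgeTerm-∧ false false q = refl

module _ {n : ℕ} (G : Hypergraph n) where

  sumEdges-mono : ∀ {f g : Subset n → ℚᵘ} → (∀ e → T (G e) → f e ≤ g e) → sumEdges G f ≤ sumEdges G g
  sumEdges-mono f≤g = sumℚ-map-mono (allSubsets n) (λ e → edgeTerm-≤ (G e) (f≤g e))

  sumEdges-+ : ∀ (f g : Subset n → ℚᵘ) → sumEdges G (λ e → f e + g e) ≃ sumEdges G f + sumEdges G g
  sumEdges-+ f g = ≃-trans (sumℚ-map-cong (allSubsets n) (λ e → edgeTerm-+ (G e) (f e) (g e)))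
                           (sumℚ-map-+ _ _ (allSubsets n))

  sumEdges-*ʳ : ∀ (f : Subset n → ℚᵘ) a → sumEdges G (λ e → f e * a) ≃ sumEdges G f * a
  sumEdges-*ʳ f a = ≃-trans (sumℚ-map-cong (allSubsets n) (λ e → edgeTerm-*ʳ (G e) (f e) a))
                            (sumℚ-map-*ʳ _ a (allSubsets n))

  sumEdges-+-*ʳ : ∀ (f g : Subset n → ℚᵘ) a →
    sumEdges G (λ e → f e + g e * a) ≃ sumEdges G f + sumEdges G g * a
  sumEdges-+-*ʳ f g a = ≃-trans (sumEdges-+ f (λ e → g e * a)) (+-congʳ (sumEdges G f) (sumEdges-*ʳ g a))

ℕ→ℚ-+ : ∀ a b → ℕ→ℚ (a ℕ.+ b) ≃ ℕ→ℚ a + ℕ→ℚ b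
ℕ→ℚ-+ a b = *≡* (cong (ℤ._* + 1) (trans (ℤₚ.pos-+ a b)
  (sym (cong₂ ℤ._+_ (ℤₚ.*-identityʳ (+ a)) (ℤₚ.*-identityʳ (+ b))))))

ℕ→ℚ-* : ∀ a b → ℕ→ℚ (a ℕ.* b) ≃ ℕ→ℚ a * ℕ→ℚ b
ℕ→ℚ-* a b = *≡* (cong (ℤ._* + 1) (ℤₚ.pos-* a b))

ℕ→ℚ-mono : ∀ {a b} → a ℕ.≤ b → ℕ→ℚ a ≤ ℕ→ℚ b
ℕ→ℚ-mono {a} {b} a≤b = *≤* (subst₂ ℤ._≤_ (sym (ℤₚ.*-identityʳ (+ a))) (sym (ℤₚ.*-identityʳ (+ b))) (ℤ.+≤+ a≤b))

ℕ→ℚ-nonNeg : ∀ a → 0ℚᵘ ≤ ℕ→ℚ a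
ℕ→ℚ-nonNeg a = ℕ→ℚ-mono z≤n

ℕ→ℚ-suc-* : ∀ a d → ℕ→ℚ a * d + d ≃ ℕ→ℚ (suc a) * d
ℕ→ℚ-suc-* a d = begin
  ℕ→ℚ a * d + d            ≈⟨ +-congʳ (ℕ→ℚ a * d) (≃-sym (*-identityˡ d)) ⟩
  ℕ→ℚ a * d + 1ℚᵘ * d      ≈⟨ ≃-sym (*-distribʳ-+ d (ℕ→ℚ a) 1ℚᵘ) ⟩
  (ℕ→ℚ a + 1ℚᵘ) * d        ≈⟨ *-congʳ {d} (≃-sym (ℕ→ℚ-+ a 1)) ⟩
  ℕ→ℚ (a ℕ.+ 1) * d        ≈⟨ *-congʳ {d} (≃-reflexive (cong ℕ→ℚ (ℕₚ.+-comm a 1))) ⟩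
  ℕ→ℚ (suc a) * d          ∎
  where open ≃-Reasoning

q≤∣↥q∣ : ∀ q → q ≤ ℕ→ℚ ℤ.∣ ↥ q ∣
q≤∣↥q∣ (mkℚᵘ (+ a)    d) = *≤* (subst₂ ℤ._≤_ (ℤₚ.pos-* a 1) (ℤₚ.pos-* a (suc d)) (ℤ.+≤+ (ℕₚ.*-monoʳ-≤ a (s≤s z≤n))))
q≤∣↥q∣ (mkℚᵘ -[1+ _ ] d) = *≤* ℤ.-≤+

inv-nonNeg : ∀ n → 0ℚᵘ ≤ inv n
inv-nonNeg zero    = ≤-refl
inv-nonNeg (suc n) = *≤* (ℤ.+≤+ z≤n)

frac : ℕ → ℕ → ℚᵘ
frac a n = ℕ→ℚ a * inv n

frac-mkℚᵘ : ∀ a b → frac a (suc b) ≃ mkℚᵘ (+ a) b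
frac-mkℚᵘ a b = *≡* (cong₂ (λ x y → x ℤ.* + suc y) (ℤₚ.*-identityʳ (+ a)) (sym (ℕₚ.+-identityʳ b)))

frac-nonNeg : ∀ a n → 0ℚᵘ ≤ frac a n
frac-nonNeg a n = ≤-respˡ-≃ (*-zeroˡ (inv n)) (*-monoˡ-≤-nonNeg (inv n) {{nonNegative (inv-nonNeg n)}} (ℕ→ℚ-nonNeg a))

frac-≤ : ∀ {a b c d} → 1 ℕ.≤ b → 1 ℕ.≤ d → a ℕ.* d ℕ.≤ c ℕ.* b → frac a b ≤ frac c d
frac-≤ {a} {suc b} {c} {suc d} _ _ ad≤cb =
  ≤-respˡ-≃ (≃-sym (frac-mkℚᵘ a b)) (≤-respʳ-≃ (≃-sym (frac-mkℚᵘ c d))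
    (*≤* (subst₂ ℤ._≤_ (ℤₚ.pos-* a (suc d)) (ℤₚ.pos-* c (suc b)) (ℤ.+≤+ ad≤cb))))

frac-< : ∀ {a b c d} → 1 ℕ.≤ b → 1 ℕ.≤ d → a ℕ.* d ℕ.< c ℕ.* b → frac a b < frac c d
frac-< {a} {suc b} {c} {suc d} _ _ ad<cb =
  ≤-<-trans (≤-reflexive (frac-mkℚᵘ a b)) (<-≤-trans
    (*<* (subst₂ ℤ._<_ (ℤₚ.pos-* a (suc d)) (ℤₚ.pos-* c (suc b)) (ℤ.+<+ ad<cb)))
    (≤-reflexive (≃-sym (frac-mkℚᵘ c d))))

frac-≤⁻¹ : ∀ {a c n} → 1 ℕ.≤ n → frac a n ≤ frac c n → a ℕ.≤ c
frac-≤⁻¹ {a} {c} {suc n} _ a/n≤c/n = ℕₚ.*-cancelʳ-≤ a c (suc n) (ℤₚ.drop‿+≤+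
  (subst₂ ℤ._≤_ (sym (ℤₚ.pos-* a (suc n))) (sym (ℤₚ.pos-* c (suc n)))
    (drop-*≤* (≤-respˡ-≃ (frac-mkℚᵘ a n) (≤-respʳ-≃ (frac-mkℚᵘ c n) a/n≤c/n)))))

frac-+ : ∀ a b n → frac (a ℕ.+ b) n ≃ frac a n + frac b n
frac-+ a b n = ≃-trans (*-congʳ {inv n} (ℕ→ℚ-+ a b)) (*-distribʳ-+ (inv n) (ℕ→ℚ a) (ℕ→ℚ b))

frac-suc : ∀ a n → frac (suc a) n ≃ frac a n + inv n
frac-suc a n = ≃-trans (≃-reflexive (cong (λ k → frac k n) (ℕₚ.+-comm 1 a)))
  (≃-trans (frac-+ a 1 n) (+-congʳ (frac a n) (*-identityˡ (inv n))))

frac-*ˡ : ∀ a b n → ℕ→ℚ a * frac b n ≃ frac (a ℕ.* b) n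
frac-*ˡ a b n = ≃-trans (≃-sym (*-assoc (ℕ→ℚ a) (ℕ→ℚ b) (inv n))) (*-congʳ {inv n} (≃-sym (ℕ→ℚ-* a b)))

frac-* : ∀ {a b c d} → 1 ℕ.≤ b → 1 ℕ.≤ d → frac a b * frac c d ≃ frac (a ℕ.* c) (b ℕ.* d)
frac-* {a} {suc b} {c} {suc d} _ _ =
  ≃-trans (*-cong (frac-mkℚᵘ a b) (frac-mkℚᵘ c d))
  (≃-trans (*≡* (cong (ℤ._* + suc (d ℕ.+ b ℕ.* suc d)) (sym (ℤₚ.pos-* a c))))
           (≃-sym (frac-mkℚᵘ (a ℕ.* c) (d ℕ.+ b ℕ.* suc d))))

frac-+-frac : ∀ {a b c d} → 1 ℕ.≤ b → 1 ℕ.≤ d → frac a b + frac c d ≃ frac (a ℕ.* d ℕ.+ c ℕ.* b) (b ℕ.* d)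
frac-+-frac {a} {suc b} {c} {suc d} _ _ =
  ≃-trans (+-cong (frac-mkℚᵘ a b) (frac-mkℚᵘ c d))
  (≃-trans (*≡* (cong (ℤ._* + suc (d ℕ.+ b ℕ.* suc d))
                      (sym (trans (ℤₚ.pos-+ (a ℕ.* suc d) (c ℕ.* suc b))
                                  (cong₂ ℤ._+_ (ℤₚ.pos-* a (suc d)) (ℤₚ.pos-* c (suc b)))))))
           (≃-sym (frac-mkℚᵘ (a ℕ.* suc d ℕ.+ c ℕ.* suc b) (d ℕ.+ b ℕ.* suc d))))

frac-n-n : ∀ {n} → 1 ℕ.≤ n → frac n n ≃ 1ℚᵘ
frac-n-n {suc n} _ = ≃-trans (frac-mkℚᵘ (suc n) n)
  (*≡* (trans (ℤₚ.*-identityʳ (+ suc n)) (sym (ℤₚ.*-identityˡ (+ suc n)))))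

-- Blow-ups

indicator : ∀ {m} → Subset m → Vec ℕ m
indicator []            = []
indicator (inside ∷ f)  = 1 ∷ indicator f
indicator (outside ∷ f) = 0 ∷ indicator f

fromIndicator : ∀ {m} → Vec ℕ m → Maybe (Subset m)
fromIndicator []                = just []
fromIndicator (0 ∷ c)           = Maybe.map (outside ∷_) (fromIndicator c)
fromIndicator (1 ∷ c)           = Maybe.map (inside ∷_) (fromIndicator c)
fromIndicator (suc (suc _) ∷ c) = nothing

map-nothing⁻¹ : ∀ {A B : Set} {f : A → B} ma → Maybe.map f ma ≡ nothing → ma ≡ nothing
map-nothing⁻¹ nothing _ = refl

fromIndicator-indicator : ∀ {m} (f : Subset m) → fromIndicator (indicator f) ≡ just f
fromIndicator-indicator []            = refl
fromIndicator-indicator (inside ∷ f)  = cong (Maybe.map (inside ∷_)) (fromIndicator-indicator f)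
fromIndicator-indicator (outside ∷ f) = cong (Maybe.map (outside ∷_)) (fromIndicator-indicator f)

fromIndicator-updateAt-suc : ∀ {m} (c : Vec ℕ m) p → fromIndicator c ≡ nothing →
  fromIndicator (updateAt c p suc) ≡ nothing
fromIndicator-updateAt-suc (0 ∷ c)           zero    c∉ =
  cong (Maybe.map (inside ∷_)) (map-nothing⁻¹ (fromIndicator c) c∉)
fromIndicator-updateAt-suc (1 ∷ c)           zero    c∉ = refl
fromIndicator-updateAt-suc (suc (suc _) ∷ c) zero    c∉ = refl
fromIndicator-updateAt-suc (0 ∷ c)           (suc p) c∉ =
  cong (Maybe.map (outside ∷_)) (fromIndicator-updateAt-suc c p (map-nothing⁻¹ (fromIndicator c) c∉))
fromIndicator-updateAt-suc (1 ∷ c)           (suc p) c∉ =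
  cong (Maybe.map (inside ∷_)) (fromIndicator-updateAt-suc c p (map-nothing⁻¹ (fromIndicator c) c∉))
fromIndicator-updateAt-suc (suc (suc _) ∷ c) (suc p) c∉ = refl

card-fromIndicator : ∀ {m} (c : Vec ℕ m) {f} → fromIndicator c ≡ just f → card f ≡ sum c
card-fromIndicator []      refl = refl
card-fromIndicator (0 ∷ c) c≡f with fromIndicator c in eq
card-fromIndicator (0 ∷ c) refl | just f = card-fromIndicator c eq
card-fromIndicator (1 ∷ c) c≡f with fromIndicator c in eq
card-fromIndicator (1 ∷ c) refl | just f = cong suc (card-fromIndicator c eq)

prodOnℕ : ∀ {m} → Subset m → Vec ℕ m → ℕ
prodOnℕ []            []      = 1
prodOnℕ (inside ∷ f)  (a ∷ c) = a ℕ.* prodOnℕ f c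
prodOnℕ (outside ∷ f) (a ∷ c) = prodOnℕ f c

multilinear : ∀ {m} → (Vec ℕ m → ℚᵘ) → Vec ℕ m → ℚᵘ
multilinear {m} g c = sumSubsets m (λ f → g (indicator f) * ℕ→ℚ (prodOnℕ f c))

ZeroOffIndicators : ∀ {m} → (Vec ℕ m → ℚᵘ) → Set
ZeroOffIndicators g = ∀ c → fromIndicator c ≡ nothing → g c ≃ 0ℚᵘ

multilinear-∷ : ∀ {m} (g : Vec ℕ (suc m) → ℚᵘ) a c →
  multilinear g (a ∷ c) ≃ multilinear (λ v → g (1 ∷ v)) c * ℕ→ℚ a + multilinear (λ v → g (0 ∷ v)) c
multilinear-∷ {m} g a c =
  ≃-trans (sumSubsets-suc m _) (+-congˡ (multilinear (λ v → g (0 ∷ v)) c)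
    (≃-trans (sumℚ-map-cong (allSubsets m) (λ f → pull-out (g (1 ∷ indicator f)) (prodOnℕ f c)))
             (sumℚ-map-*ʳ _ (ℕ→ℚ a) (allSubsets m))))
  where
  *-rotate : ∀ x y z → x * (y * z) ≃ x * z * y
  *-rotate = solve-∀ ℚᵘ-ring
  pull-out : ∀ x p → x * ℕ→ℚ (a ℕ.* p) ≃ x * ℕ→ℚ p * ℕ→ℚ a
  pull-out x p = ≃-trans (*-congˡ {x} (ℕ→ℚ-* a p)) (*-rotate x (ℕ→ℚ a) (ℕ→ℚ p))

multilinear-zero : ∀ {m} (g : Vec ℕ m → ℚᵘ) c → (∀ v → g v ≃ 0ℚᵘ) → multilinear g c ≃ 0ℚᵘ
multilinear-zero {m} g c g≃0 = sumℚ-map-zero (allSubsets m)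
  (λ f → ≃-trans (*-congʳ {ℕ→ℚ (prodOnℕ f c)} (g≃0 (indicator f))) (*-zeroˡ (ℕ→ℚ (prodOnℕ f c))))

multilinear-replicate-0 : ∀ {m} (g : Vec ℕ m → ℚᵘ) → multilinear g (replicate m 0) ≃ g (replicate m 0)
multilinear-replicate-0 {zero}  g = ≃-trans (+-identityʳ _) (*-identityʳ _)
multilinear-replicate-0 {suc m} g = begin
  M g (0 ∷ 0s)                   ≈⟨ multilinear-∷ g 0 0s ⟩
  M g₁ 0s * 0ℚᵘ + M g₀ 0s         ≈⟨ +-cong (*-zeroʳ (M g₁ 0s)) (multilinear-replicate-0 g₀) ⟩
  0ℚᵘ + g (0 ∷ 0s)               ≈⟨ +-identityˡ (g (0 ∷ 0s)) ⟩
  g (0 ∷ 0s)                     ∎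
  where
  open ≃-Reasoning
  M = multilinear
  0s = replicate m 0
  g₀ g₁ : Vec ℕ m → ℚᵘ
  g₀ v = g (0 ∷ v)
  g₁ v = g (1 ∷ v)

-- The product rule for multilinear forms; the term with a 2 at position p vanishes.
multilinear-updateAt-suc : ∀ {m} (g : Vec ℕ m → ℚᵘ) → ZeroOffIndicators g → ∀ c p →
  multilinear g (updateAt c p suc) ≃ multilinear g c + multilinear (λ v → g (updateAt v p suc)) c
multilinear-updateAt-suc g g-ind (a ∷ c) zero = begin
  M g (suc a ∷ c)                             ≈⟨ multilinear-∷ g (suc a) c ⟩
  M g₁ c * ℕ→ℚ (suc a) + M g₀ c               ≈⟨ +-congˡ (M g₀ c) (*-congˡ {M g₁ c} (ℕ→ℚ-+ 1 a)) ⟩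
  M g₁ c * (1ℚᵘ + ℕ→ℚ a) + M g₀ c             ≈⟨ rearrange (M g₁ c) 1ℚᵘ (ℕ→ℚ a) (M g₀ c) ⟩
  (M g₁ c * ℕ→ℚ a + M g₀ c) + M g₁ c * 1ℚᵘ   ≈⟨ +-congʳ (M g₁ c * ℕ→ℚ a + M g₀ c) M₁*1≃M₂*a+M₁ ⟩
  (M g₁ c * ℕ→ℚ a + M g₀ c) + (M g₂ c * ℕ→ℚ a + M g₁ c)
    ≈⟨ ≃-sym (+-cong (multilinear-∷ g a c) (multilinear-∷ (λ v → g (updateAt v zero suc)) a c)) ⟩
  M g (a ∷ c) + M (λ v → g (updateAt v zero suc)) (a ∷ c) ∎
  where
  open ≃-Reasoning
  M = multilinear
  g₀ g₁ g₂ : Vec ℕ _ → ℚᵘ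
  g₀ v = g (0 ∷ v)
  g₁ v = g (1 ∷ v)
  g₂ v = g (2 ∷ v)
  M₂≃0 : M g₂ c ≃ 0ℚᵘ
  M₂≃0 = multilinear-zero g₂ c (λ v → g-ind (2 ∷ v) refl)
  M₁*1≃M₂*a+M₁ : M g₁ c * 1ℚᵘ ≃ M g₂ c * ℕ→ℚ a + M g₁ c
  M₁*1≃M₂*a+M₁ = begin
    M g₁ c * 1ℚᵘ             ≈⟨ *-identityʳ (M g₁ c) ⟩
    M g₁ c                   ≈⟨ ≃-sym (+-identityˡ (M g₁ c)) ⟩
    0ℚᵘ + M g₁ c             ≈⟨ +-congˡ (M g₁ c) (≃-sym (*-zeroˡ (ℕ→ℚ a))) ⟩
    0ℚᵘ * ℕ→ℚ a + M g₁ c     ≈⟨ +-congˡ (M g₁ c) (*-congʳ {ℕ→ℚ a} (≃-sym M₂≃0)) ⟩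
    M g₂ c * ℕ→ℚ a + M g₁ c  ∎
  rearrange : ∀ x o y z → x * (o + y) + z ≃ (x * y + z) + x * o
  rearrange = solve-∀ ℚᵘ-ring
multilinear-updateAt-suc g g-ind (a ∷ c) (suc p) = begin
  M g (a ∷ up c)                              ≈⟨ multilinear-∷ g a (up c) ⟩
  M g₁ (up c) * ℕ→ℚ a + M g₀ (up c)
    ≈⟨ +-cong (*-congʳ {ℕ→ℚ a} (multilinear-updateAt-suc g₁ (λ v v∉ → g-ind (1 ∷ v) (map-nothing v∉)) c p))
              (multilinear-updateAt-suc g₀ (λ v v∉ → g-ind (0 ∷ v) (map-nothing v∉)) c p) ⟩
  (M g₁ c + M (g₁ ∘up) c) * ℕ→ℚ a + (M g₀ c + M (g₀ ∘up) c)
    ≈⟨ rearrange (M g₁ c) (M (g₁ ∘up) c) (ℕ→ℚ a) (M g₀ c) (M (g₀ ∘up) c) ⟩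
  (M g₁ c * ℕ→ℚ a + M g₀ c) + (M (g₁ ∘up) c * ℕ→ℚ a + M (g₀ ∘up) c)
    ≈⟨ ≃-sym (+-cong (multilinear-∷ g a c) (multilinear-∷ (λ v → g (updateAt v (suc p) suc)) a c)) ⟩
  M g (a ∷ c) + M (λ v → g (updateAt v (suc p) suc)) (a ∷ c) ∎
  where
  open ≃-Reasoning
  M = multilinear
  up : Vec ℕ _ → Vec ℕ _
  up v = updateAt v p suc
  g₀ g₁ : Vec ℕ _ → ℚᵘ
  g₀ v = g (0 ∷ v)
  g₁ v = g (1 ∷ v)
  _∘up : (Vec ℕ _ → ℚᵘ) → Vec ℕ _ → ℚᵘ
  (h ∘up) v = h (up v)
  rearrange : ∀ x x′ a y y′ → (x + x′) * a + (y + y′) ≃ (x * a + y) + (x′ * a + y′)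
  rearrange = solve-∀ ℚᵘ-ring

profile : ∀ {m n} → Vec (Fin m) n → Subset n → Vec ℕ m
profile {m} []      []            = replicate m 0
profile     (p ∷ π) (inside ∷ e)  = updateAt (profile π e) p suc
profile     (p ∷ π) (outside ∷ e) = profile π e

sum-updateAt-suc : ∀ {m} (c : Vec ℕ m) p → sum (updateAt c p suc) ≡ suc (sum c)
sum-updateAt-suc (a ∷ c) zero    = refl
sum-updateAt-suc (a ∷ c) (suc p) = trans (cong (a ℕ.+_) (sum-updateAt-suc c p)) (ℕₚ.+-suc a (sum c))

sum-replicate-0 : ∀ m → sum (replicate m 0) ≡ 0
sum-replicate-0 zero    = refl
sum-replicate-0 (suc m) = sum-replicate-0 m

sum-indicator : ∀ {m} (f : Subset m) → sum (indicator f) ≡ card f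
sum-indicator []            = refl
sum-indicator (inside ∷ f)  = cong suc (sum-indicator f)
sum-indicator (outside ∷ f) = sum-indicator f

sum-profile : ∀ {m n} (π : Vec (Fin m) n) e → sum (profile π e) ≡ card e
sum-profile {m} []      []            = sum-replicate-0 m
sum-profile     (p ∷ π) (inside ∷ e)  = trans (sum-updateAt-suc (profile π e) p) (cong suc (sum-profile π e))
sum-profile     (p ∷ π) (outside ∷ e) = sum-profile π e

infix 4 _⊆ᵇ_
_⊆ᵇ_ : ∀ {n} → Subset n → Subset n → Bool
[]            ⊆ᵇ []            = true
(outside ∷ e) ⊆ᵇ (_ ∷ S)       = e ⊆ᵇ S
(inside ∷ e)  ⊆ᵇ (inside ∷ S)  = e ⊆ᵇ S
(inside ∷ e)  ⊆ᵇ (outside ∷ S) = false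

⊆ᵇ-⊤ : ∀ {n} (e : Subset n) → (e ⊆ᵇ ⊤) ≡ true
⊆ᵇ-⊤ []            = refl
⊆ᵇ-⊤ (inside ∷ e)  = ⊆ᵇ-⊤ e
⊆ᵇ-⊤ (outside ∷ e) = ⊆ᵇ-⊤ e

edgeIn-complete : ∀ {n} (S e : Subset n) → edgeIn (λ _ → true) S e ≡ (e ⊆ᵇ S)
edgeIn-complete []            []            = refl
edgeIn-complete (_ ∷ S)       (outside ∷ e) = edgeIn-complete S e
edgeIn-complete (inside ∷ S)  (inside ∷ e)  = edgeIn-complete S e
edgeIn-complete (outside ∷ S) (inside ∷ e)  = refl

edgeIn-⊆ᵇ : ∀ {n} (G : Hypergraph n) S e → edgeIn G S e ≡ (G e ∧ (e ⊆ᵇ S))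
edgeIn-⊆ᵇ G S e with G e
... | false = refl
... | true  = edgeIn-complete S e

sumEdges-edgeIn-⊤ : ∀ {n} (G : Hypergraph n) w → sumEdges (edgeIn G ⊤) w ≡ sumEdges G w
sumEdges-edgeIn-⊤ {n} G w = cong sumℚ (map-cong edgeTerm-⊤ (allSubsets n))
  where
  edgeTerm-⊤ : ∀ e → edgeTerm (edgeIn G ⊤ e) (w e) ≡ edgeTerm (G e) (w e)
  edgeTerm-⊤ e = cong (λ b → edgeTerm b (w e))
    (trans (edgeIn-⊆ᵇ G ⊤ e) (trans (cong (G e ∧_) (⊆ᵇ-⊤ e)) (∧-identityʳ (G e))))

sumSubsets-profile : ∀ {m n} (π : Vec (Fin m) n) S (g : Vec ℕ m → ℚᵘ) → ZeroOffIndicators g →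
  sumSubsets n (λ e → edgeTerm (e ⊆ᵇ S) (g (profile π e))) ≃ multilinear g (profile π S)
sumSubsets-profile {m} [] [] g g-ind = ≃-trans (+-identityʳ _) (≃-sym (multilinear-replicate-0 g))
sumSubsets-profile {n = suc n} (p ∷ π) (inside ∷ S) g g-ind =
  ≃-trans (sumSubsets-suc n _)
  (≃-trans (+-cong (sumSubsets-profile π S (λ v → g (updateAt v p suc))
                      (λ v v∉ → g-ind (updateAt v p suc) (fromIndicator-updateAt-suc v p v∉)))
                   (sumSubsets-profile π S g g-ind))
  (≃-trans (+-comm (multilinear (λ v → g (updateAt v p suc)) (profile π S)) (multilinear g (profile π S)))
           (≃-sym (multilinear-updateAt-suc g g-ind (profile π S) p))))
sumSubsets-profile {n = suc n} (p ∷ π) (outside ∷ S) g g-ind =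
  ≃-trans (sumSubsets-suc n _)
  (≃-trans (+-congˡ _ (sumℚ-map-zero (allSubsets n) (λ _ → ≃-refl)))
  (≃-trans (+-identityˡ _) (sumSubsets-profile π S g g-ind)))

hasEdgeProfile : ∀ {m} → Hypergraph m → Vec ℕ m → Bool
hasEdgeProfile F c = maybe′ F false (fromIndicator c)

hasEdgeProfile-indicator : ∀ {m} (F : Hypergraph m) f → hasEdgeProfile F (indicator f) ≡ F f
hasEdgeProfile-indicator F f = cong (maybe′ F false) (fromIndicator-indicator f)

-- e is an edge iff π is injective on e and maps it onto an edge of F.
blowUp : ∀ {m n} → Hypergraph m → Vec (Fin m) n → Hypergraph n
blowUp F π e = hasEdgeProfile F (profile π e)

blowUp-isRGraph : ∀ {m n} R (F : Hypergraph m) (π : Vec (Fin m) n) → IsRGraph R F → IsRGraph R (blowUp F π)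
blowUp-isRGraph R F π F-R e e∈ with fromIndicator (profile π e) in eq
... | just f = subst (_∈ R) (trans (card-fromIndicator (profile π e) eq) (sum-profile π e)) (F-R f e∈)

sumEdges-edgeIn-blowUp : ∀ {m n} (F : Hypergraph m) (π : Vec (Fin m) n) S (w : ℕ → ℚᵘ) →
  sumEdges (edgeIn (blowUp F π) S) (λ e → w (card e)) ≃
  sumEdges F (λ f → w (card f) * ℕ→ℚ (prodOnℕ f (profile π S)))
sumEdges-edgeIn-blowUp {m} {n} F π S w =
  ≃-trans (≃-reflexive (cong sumℚ (map-cong edgeTerm-edgeIn (allSubsets n))))
  (≃-trans (sumSubsets-profile π S g g-ind)
           (sumℚ-map-cong (allSubsets m) λ f → ≃-trans (*-congʳ {ℕ→ℚ (prodOnℕ f s)} (≃-reflexive (g-indicator f)))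
                                                        (≃-sym (edgeTerm-*ʳ (F f) _ _))))
  where
  s = profile π S
  g : Vec ℕ m → ℚᵘ
  g c = edgeTerm (hasEdgeProfile F c) (w (sum c))
  g-ind : ZeroOffIndicators g
  g-ind c c∉ rewrite c∉ = ≃-refl
  g-indicator : ∀ f → g (indicator f) ≡ edgeTerm (F f) (w (card f))
  g-indicator f = cong₂ (λ b r → edgeTerm b (w r)) (hasEdgeProfile-indicator F f) (sum-indicator f)
  edgeTerm-edgeIn : ∀ e → edgeTerm (edgeIn (blowUp F π) S e) (w (card e)) ≡ edgeTerm (e ⊆ᵇ S) (g (profile π e))
  edgeTerm-edgeIn e = trans (cong (λ b → edgeTerm b (w (card e))) (edgeIn-⊆ᵇ (blowUp F π) S e))
    (trans (edgeTerm-∧ (blowUp F π e) (e ⊆ᵇ S) (w (card e)))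
           (cong (λ r → edgeTerm (e ⊆ᵇ S) (edgeTerm (blowUp F π e) (w r))) (sym (sum-profile π e))))

labelling : ∀ {m} (k : Vec ℕ m) → Vec (Fin m) (sum k)
labelling []      = []
labelling (a ∷ k) = replicate a zero Vec.++ Vec.map suc (labelling k)

profile-map-suc : ∀ {m n} (π : Vec (Fin m) n) → profile (Vec.map suc π) ⊤ ≡ 0 ∷ profile π ⊤
profile-map-suc []      = refl
profile-map-suc (p ∷ π) = cong (λ c → updateAt c (suc p) suc) (profile-map-suc π)

profile-replicate-zero-++ : ∀ {m n} a (π : Vec (Fin (suc m)) n) {b c} → profile π ⊤ ≡ b ∷ c →
  profile (replicate a zero Vec.++ π) ⊤ ≡ (a ℕ.+ b) ∷ c
profile-replicate-zero-++ zero    π eq = eq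
profile-replicate-zero-++ (suc a) π eq = cong (λ c → updateAt c zero suc) (profile-replicate-zero-++ a π eq)

profile-labelling : ∀ {m} (k : Vec ℕ m) → profile (labelling k) ⊤ ≡ k
profile-labelling []      = refl
profile-labelling (a ∷ k) =
  trans (profile-replicate-zero-++ a (Vec.map suc (labelling k))
          (trans (profile-map-suc (labelling k)) (cong (0 ∷_) (profile-labelling k))))
        (cong (_∷ k) (ℕₚ.+-identityʳ a))

-- Lagrangians at grid points

gridPoint : ∀ {m} → Vec ℕ m → ℕ → Fin m → ℚᵘ
gridPoint k n i = frac (lookup k i) n

prodOn-gridPoint : ∀ {m} (f : Subset m) (k : Vec ℕ m) {n} → 1 ℕ.≤ n →
  prodOn f (gridPoint k n) ≃ frac (prodOnℕ f k) (n ^ card f)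
prodOn-gridPoint []            []      {n} _   = ≃-sym (*-identityʳ 1ℚᵘ)
prodOn-gridPoint (inside ∷ f)  (a ∷ k) {n} 1≤n =
  ≃-trans (*-congˡ {frac a n} (prodOn-gridPoint f k 1≤n))
          (frac-* 1≤n (ℕₚ.m^n>0 n {{ℕ.>-nonZero 1≤n}} (card f)))
prodOn-gridPoint (outside ∷ f) (a ∷ k) {n} 1≤n = prodOn-gridPoint f k 1≤n

k!*[p/n^k]≤[1/nCk]*p : ∀ {n k} p → 1 ℕ.≤ n → k ℕ.≤ n → ℕ→ℚ (k !) * frac p (n ^ k) ≤ inv (n C k) * ℕ→ℚ p
k!*[p/n^k]≤[1/nCk]*p {n} {k} p 1≤n k≤n =
  ≤-respˡ-≃ (≃-sym (frac-*ˡ (k !) p (n ^ k))) (≤-respʳ-≃ (*-comm (ℕ→ℚ p) (inv (n C k)))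
    (frac-≤ (ℕₚ.m^n>0 n {{ℕ.>-nonZero 1≤n}} k) (nCk>0 k≤n) (k!*p*nCk≤p*n^k p k≤n)))

[1/nCk]*p≤k!*[p/n^k]+2k!k²/n : ∀ {n k p} → 1 ℕ.≤ n → k ℕ.≤ n → 2 ℕ.* k ℕ.* k ℕ.≤ n → p ℕ.≤ n ^ k →
  inv (n C k) * ℕ→ℚ p ≤ ℕ→ℚ (k !) * frac p (n ^ k) + frac (2 ℕ.* k ! ℕ.* k ℕ.* k) n
[1/nCk]*p≤k!*[p/n^k]+2k!k²/n {n} {k} {p} 1≤n k≤n 2k²≤n p≤n^k =
  ≤-respˡ-≃ (*-comm (ℕ→ℚ p) (inv (n C k)))
  (≤-respʳ-≃ (≃-sym (≃-trans (+-congˡ (frac (2 ℕ.* k ! ℕ.* k ℕ.* k) n) (frac-*ˡ (k !) p (n ^ k)))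
                             (frac-+-frac n^k>0 1≤n)))
  (frac-≤ (nCk>0 k≤n) (ℕₚ.*-mono-≤ n^k>0 1≤n) (p*n^k*n≤[k!*p*n+2*k!*k*k*n^k]*nCk 1≤n k≤n 2k²≤n p≤n^k)))
  where
  n^k>0 : 1 ℕ.≤ n ^ k
  n^k>0 = ℕₚ.m^n>0 n {{ℕ.>-nonZero 1≤n}} k

InUnitCube : ∀ {m} → (Fin m → ℚᵘ) → Set
InUnitCube {m} x = (∀ i → 0ℚᵘ ≤ x i) × (∀ i → x i ≤ 1ℚᵘ)

InUnitCube-tail : ∀ {m} {x : Fin (suc m) → ℚᵘ} → InUnitCube x → InUnitCube (λ i → x (suc i))
InUnitCube-tail (x≥0 , x≤1) = (λ i → x≥0 (suc i)) , (λ i → x≤1 (suc i))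

*-≤-1 : ∀ {p q} → 0ℚᵘ ≤ q → p ≤ 1ℚᵘ → p * q ≤ q
*-≤-1 {p} {q} q≥0 p≤1 = ≤-respʳ-≃ (*-identityˡ q) (*-monoˡ-≤-nonNeg q {{nonNegative q≥0}} p≤1)

*-nonNeg : ∀ {p q} → 0ℚᵘ ≤ p → 0ℚᵘ ≤ q → 0ℚᵘ ≤ p * q
*-nonNeg {p} {q} p≥0 q≥0 = ≤-respˡ-≃ (*-zeroˡ q) (*-monoˡ-≤-nonNeg q {{nonNegative q≥0}} p≥0)

prodOn-nonNeg : ∀ {m} (f : Subset m) x → InUnitCube x → 0ℚᵘ ≤ prodOn f x
prodOn-nonNeg []            x x∈ = *≤* (ℤ.+≤+ z≤n)
prodOn-nonNeg (inside ∷ f)  x x∈ = *-nonNeg (proj₁ x∈ zero) (prodOn-nonNeg f _ (InUnitCube-tail x∈))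
prodOn-nonNeg (outside ∷ f) x x∈ = prodOn-nonNeg f _ (InUnitCube-tail x∈)

prodOn-≤-1 : ∀ {m} (f : Subset m) x → InUnitCube x → prodOn f x ≤ 1ℚᵘ
prodOn-≤-1 []            x x∈ = ≤-refl
prodOn-≤-1 (inside ∷ f)  x x∈ =
  ≤-trans (*-≤-1 (prodOn-nonNeg f _ (InUnitCube-tail x∈)) (proj₂ x∈ zero)) (prodOn-≤-1 f _ (InUnitCube-tail x∈))
prodOn-≤-1 (outside ∷ f) x x∈ = prodOn-≤-1 f _ (InUnitCube-tail x∈)

prodOn-lipschitz : ∀ {m} (f : Subset m) {x y} d → InUnitCube x → InUnitCube y → 0ℚᵘ ≤ d →
  (∀ i → x i ≤ y i + d) → prodOn f x ≤ prodOn f y + ℕ→ℚ (card f) * d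
prodOn-lipschitz [] d _ _ _ _ = ≤-respʳ-≃ (≃-sym (≃-trans (+-congʳ 1ℚᵘ (*-zeroˡ d)) (+-identityʳ 1ℚᵘ))) ≤-refl
prodOn-lipschitz (inside ∷ f) {x} {y} d x∈ y∈ d≥0 x≤y+d = begin
  x₀ * Px                                ≤⟨ *-monoˡ-≤-nonNeg Px {{nonNegative Px≥0}} (x≤y+d zero) ⟩
  (y₀ + d) * Px                          ≃⟨ *-distribʳ-+ Px y₀ d ⟩
  y₀ * Px + d * Px
    ≤⟨ +-mono-≤ (*-monoʳ-≤-nonNeg y₀ {{nonNegative (proj₁ y∈ zero)}} Px≤Py+rd)
                (*-monoʳ-≤-nonNeg d {{nonNegative d≥0}} (prodOn-≤-1 f _ x′∈)) ⟩
  y₀ * (Py + r * d) + d * 1ℚᵘ            ≃⟨ +-cong (*-distribˡ-+ y₀ Py (r * d)) (*-identityʳ d) ⟩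
  y₀ * Py + y₀ * (r * d) + d
    ≤⟨ +-monoˡ-≤ d (+-monoʳ-≤ (y₀ * Py) (*-≤-1 (*-nonNeg (ℕ→ℚ-nonNeg (card f)) d≥0) (proj₂ y∈ zero))) ⟩
  y₀ * Py + r * d + d                    ≃⟨ +-assoc (y₀ * Py) (r * d) d ⟩
  y₀ * Py + (r * d + d)                  ≃⟨ +-congʳ (y₀ * Py) (ℕ→ℚ-suc-* (card f) d) ⟩
  y₀ * Py + ℕ→ℚ (suc (card f)) * d      ∎
  where
  open ≤-Reasoning
  x₀ = x zero
  y₀ = y zero
  x′∈ = InUnitCube-tail x∈
  Px = prodOn f (λ i → x (suc i))
  Py = prodOn f (λ i → y (suc i))
  r = ℕ→ℚ (card f)
  Px≥0 : 0ℚᵘ ≤ Px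
  Px≥0 = prodOn-nonNeg f _ x′∈
  Px≤Py+rd : Px ≤ Py + r * d
  Px≤Py+rd = prodOn-lipschitz f d x′∈ (InUnitCube-tail y∈) d≥0 (λ i → x≤y+d (suc i))
prodOn-lipschitz (outside ∷ f) d x∈ y∈ d≥0 x≤y+d =
  prodOn-lipschitz f d (InUnitCube-tail x∈) (InUnitCube-tail y∈) d≥0 (λ i → x≤y+d (suc i))

lipschitzConstant : ∀ {m} → Hypergraph m → ℚᵘ
lipschitzConstant F = sumEdges F (λ f → ℕ→ℚ (card f ! ℕ.* card f))

lagPoly-lipschitz : ∀ {m} (F : Hypergraph m) {x y} d → InUnitCube x → InUnitCube y → 0ℚᵘ ≤ d →
  (∀ i → x i ≤ y i + d) → lagPoly F x ≤ lagPoly F y + lipschitzConstant F * d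
lagPoly-lipschitz F {x} {y} d x∈ y∈ d≥0 x≤y+d =
  ≤-trans (sumEdges-mono F edgewise) (≤-reflexive (sumEdges-+-*ʳ F (λ f → a f * prodOn f y) (λ f → ℕ→ℚ (b f)) d))
  where
  a : Subset _ → ℚᵘ
  a f = ℕ→ℚ (card f !)
  b : Subset _ → ℕ
  b f = card f ! ℕ.* card f
  edgewise : ∀ f → T (F f) → a f * prodOn f x ≤ a f * prodOn f y + ℕ→ℚ (b f) * d
  edgewise f _ = begin
    a f * prodOn f x                              ≤⟨ *-monoʳ-≤-nonNeg (a f) {{nonNegative (ℕ→ℚ-nonNeg (card f !))}}
                                                       (prodOn-lipschitz f d x∈ y∈ d≥0 x≤y+d) ⟩
    a f * (prodOn f y + ℕ→ℚ (card f) * d)         ≃⟨ *-distribˡ-+ (a f) (prodOn f y) _ ⟩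
    a f * prodOn f y + a f * (ℕ→ℚ (card f) * d)   ≃⟨ +-congʳ (a f * prodOn f y) (≃-sym (*-assoc (a f) (ℕ→ℚ (card f)) d)) ⟩
    a f * prodOn f y + a f * ℕ→ℚ (card f) * d     ≃⟨ +-congʳ (a f * prodOn f y) (*-congʳ {d} (≃-sym (ℕ→ℚ-* (card f !) (card f)))) ⟩
    a f * prodOn f y + ℕ→ℚ (b f) * d              ∎
    where open ≤-Reasoning

-- Approximation by grid points

sumFin-nonNeg : ∀ m (x : Fin m → ℚᵘ) → (∀ i → 0ℚᵘ ≤ x i) → 0ℚᵘ ≤ sumFin m x
sumFin-nonNeg zero    x x≥0 = ≤-refl
sumFin-nonNeg (suc m) x x≥0 = +-mono-≤ (x≥0 zero) (sumFin-nonNeg m (λ i → x (suc i)) (λ i → x≥0 (suc i)))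

x≤sumFin : ∀ m (x : Fin m → ℚᵘ) → (∀ i → 0ℚᵘ ≤ x i) → ∀ i → x i ≤ sumFin m x
x≤sumFin (suc m) x x≥0 zero    =
  ≤-respˡ-≃ (+-identityʳ (x zero)) (+-monoʳ-≤ (x zero) (sumFin-nonNeg m (λ i → x (suc i)) (λ i → x≥0 (suc i))))
x≤sumFin (suc m) x x≥0 (suc i) =
  ≤-respˡ-≃ (+-identityˡ (x (suc i))) (+-mono-≤ (x≥0 zero) (x≤sumFin m (λ i → x (suc i)) (λ i → x≥0 (suc i)) i))

sumFin-mono : ∀ m {x y : Fin m → ℚᵘ} → (∀ i → x i ≤ y i) → sumFin m x ≤ sumFin m y
sumFin-mono zero    x≤y = ≤-refl
sumFin-mono (suc m) x≤y = +-mono-≤ (x≤y zero) (sumFin-mono m (λ i → x≤y (suc i)))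

sumFin-frac : ∀ m (a : Fin m → ℕ) n → sumFin m (λ i → frac (a i) n) ≃ frac (sum (tabulate a)) n
sumFin-frac zero    a n = ≃-sym (*-zeroˡ (inv n))
sumFin-frac (suc m) a n = ≃-trans (+-congʳ (frac (a zero) n) (sumFin-frac m (λ i → a (suc i)) n))
                                  (≃-sym (frac-+ (a zero) (sum (tabulate (λ i → a (suc i)))) n))

InSimplex⇒InUnitCube : ∀ {m} {x : Fin m → ℚᵘ} → InSimplex x → InUnitCube x
InSimplex⇒InUnitCube {m} {x} (x≥0 , Σx≃1) = x≥0 , λ i → ≤-respʳ-≃ Σx≃1 (x≤sumFin m x x≥0 i)

gridPoint-InSimplex : ∀ {m} (k : Vec ℕ m) {n} → 1 ℕ.≤ n → sum k ≡ n → InSimplex (gridPoint k n)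
gridPoint-InSimplex {m} k {n} 1≤n Σk≡n =
  (λ i → frac-nonNeg (lookup k i) n) ,
  ≃-trans (sumFin-frac m (lookup k) n)
          (≃-trans (≃-reflexive (cong (λ a → frac a n) (trans (cong sum (tabulate∘lookup k)) Σk≡n))) (frac-n-n 1≤n))

-- ⌊x n⌋ for x ≥ 0 (junk 0 for negative x).
floorMul : ℚᵘ → ℕ → ℕ
floorMul (mkℚᵘ (+ a)    d) n = (a ℕ.* n) / suc d
floorMul (mkℚᵘ -[1+ _ ] d) n = 0

floorMul-≤ : ∀ {x} n → 0ℚᵘ ≤ x → 1 ℕ.≤ n → frac (floorMul x n) n ≤ x
floorMul-≤ {mkℚᵘ (+ a)    d} n _ 1≤n =
  ≤-respʳ-≃ (frac-mkℚᵘ a d) (frac-≤ {b = n} {c = a} 1≤n (s≤s z≤n) (m/n*n≤m (a ℕ.* n) (suc d)))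
floorMul-≤ {mkℚᵘ -[1+ _ ] d} n (*≤* ()) _

≤floorMul+1 : ∀ {x} n → 0ℚᵘ ≤ x → 1 ℕ.≤ n → x ≤ frac (suc (floorMul x n)) n
≤floorMul+1 {mkℚᵘ (+ a)    d} n _ 1≤n =
  ≤-respˡ-≃ (frac-mkℚᵘ a d) (frac-≤ {a = a} {c = suc q} (s≤s z≤n) 1≤n
    (subst (ℕ._≤ suc q ℕ.* suc d) (sym (m≡m%n+[m/n]*n (a ℕ.* n) (suc d)))
           (ℕₚ.+-monoˡ-≤ (q ℕ.* suc d) (ℕₚ.<⇒≤ (m%n<n (a ℕ.* n) (suc d))))))
  where q = (a ℕ.* n) / suc d
≤floorMul+1 {mkℚᵘ -[1+ _ ] d} n (*≤* ()) _

roundToGrid : ∀ {m} (x : Fin (suc m) → ℚᵘ) → InSimplex x → ∀ {n} → 1 ℕ.≤ n →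
  Σ (Vec ℕ (suc m)) λ k → sum k ≡ n × (∀ i → x i ≤ gridPoint k n i + inv n)
roundToGrid {m} x (x≥0 , Σx≃1) {n} 1≤n = k , Σk≡n , x≤k/n+1/n
  where
  a : Fin (suc m) → ℕ
  a i = floorMul (x i) n
  A = sum (tabulate a)
  A≤n : A ℕ.≤ n
  A≤n = frac-≤⁻¹ 1≤n (begin
    frac A n                     ≃⟨ ≃-sym (sumFin-frac (suc m) a n) ⟩
    sumFin (suc m) (λ i → frac (a i) n) ≤⟨ sumFin-mono (suc m) (λ i → floorMul-≤ n (x≥0 i) 1≤n) ⟩
    sumFin (suc m) x             ≃⟨ Σx≃1 ⟩
    1ℚᵘ                          ≃⟨ ≃-sym (frac-n-n 1≤n) ⟩
    frac n n                     ∎)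
    where open ≤-Reasoning
  k : Vec ℕ (suc m)
  k = (n ∸ sum (tabulate (λ i → a (suc i)))) ∷ tabulate (λ i → a (suc i))
  Σk≡n : sum k ≡ n
  Σk≡n = ℕₚ.m∸n+n≡m (ℕₚ.m+n≤o⇒n≤o (a zero) A≤n)
  a≤k : ∀ i → a i ℕ.≤ lookup k i
  a≤k zero    = ℕₚ.m+n≤o⇒m≤o∸n (a zero) A≤n
  a≤k (suc i) = ℕₚ.≤-reflexive (sym (lookup∘tabulate (λ i → a (suc i)) i))
  x≤k/n+1/n : ∀ i → x i ≤ gridPoint k n i + inv n
  x≤k/n+1/n i = ≤-trans (≤floorMul+1 n (x≥0 i) 1≤n)
    (≤-respʳ-≃ (frac-suc (lookup k i) n) (frac-≤ 1≤n 1≤n (ℕₚ.*-monoˡ-≤ n (s≤s (a≤k i)))))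

argmax-≤ : (ψ : ℕ → ℚᵘ) → ∀ n → Σ ℕ λ a → a ℕ.≤ n × (∀ b → b ℕ.≤ n → ψ b ≤ ψ a)
argmax-≤ ψ zero = 0 , z≤n , λ { _ z≤n → ≤-refl }
argmax-≤ ψ (suc n) with argmax-≤ ψ n
... | a , a≤n , ψa-max with ≤-total (ψ a) (ψ (suc n))
...   | inj₁ ψa≤ψ[1+n] = suc n , ℕₚ.≤-refl , maximal
  where
  maximal : ∀ b → b ℕ.≤ suc n → ψ b ≤ ψ (suc n)
  maximal b b≤1+n with ℕₚ.m≤n⇒m<n∨m≡n b≤1+n
  ... | inj₁ (s≤s b≤n) = ≤-trans (ψa-max b b≤n) ψa≤ψ[1+n]
  ... | inj₂ refl      = ≤-refl
...   | inj₂ ψ[1+n]≤ψa = a , ℕₚ.m≤n⇒m≤1+n a≤n , maximal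
  where
  maximal : ∀ b → b ℕ.≤ suc n → ψ b ≤ ψ a
  maximal b b≤1+n with ℕₚ.m≤n⇒m<n∨m≡n b≤1+n
  ... | inj₁ (s≤s b≤n) = ψa-max b b≤n
  ... | inj₂ refl      = ψ[1+n]≤ψa

argmax-compositions : ∀ m n (φ : Vec ℕ (suc m) → ℚᵘ) →
  Σ (Vec ℕ (suc m)) λ k → sum k ≡ n × (∀ k′ → sum k′ ≡ n → φ k′ ≤ φ k)
argmax-compositions zero n φ = (n ∷ []) , ℕₚ.+-identityʳ n , maximal
  where
  maximal : ∀ k′ → sum k′ ≡ n → φ k′ ≤ φ (n ∷ [])
  maximal (b ∷ []) b+0≡n = ≤-reflexive-≡ (cong (λ c → φ (c ∷ [])) (trans (sym (ℕₚ.+-identityʳ b)) b+0≡n))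
argmax-compositions (suc m) n φ = (a ∷ best a) , Σ≡n , maximal
  where
  bestTail : ∀ a → Σ (Vec ℕ (suc m)) λ v → sum v ≡ n ∸ a × (∀ v′ → sum v′ ≡ n ∸ a → φ (a ∷ v′) ≤ φ (a ∷ v))
  bestTail a = argmax-compositions m (n ∸ a) (λ v → φ (a ∷ v))
  best : ℕ → Vec ℕ (suc m)
  best a = proj₁ (bestTail a)
  bestHead = argmax-≤ (λ a → φ (a ∷ best a)) n
  a = proj₁ bestHead
  Σ≡n : a ℕ.+ sum (best a) ≡ n
  Σ≡n = trans (cong (a ℕ.+_) (proj₁ (proj₂ (bestTail a)))) (ℕₚ.m+[n∸m]≡n (proj₁ (proj₂ bestHead)))
  maximal : ∀ k′ → sum k′ ≡ n → φ k′ ≤ φ (a ∷ best a)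
  maximal (b ∷ v) b+Σv≡n =
    ≤-trans (proj₂ (proj₂ (bestTail b)) v (trans (sym (ℕₚ.m+n∸m≡n b (sum v))) (cong (_∸ b) b+Σv≡n)))
            (proj₂ (proj₂ bestHead) b (subst (b ℕ.≤_) b+Σv≡n (ℕₚ.m≤m+n b (sum v))))

Eventually : (ℕ → Set) → Set
Eventually P = Σ ℕ λ N → ∀ n → N ℕ.≤ n → P n

eventually-≥ : ∀ M → Eventually (M ℕ.≤_)
eventually-≥ M = M , λ _ M≤n → M≤n

infixr 2 _×ᵉ_
_×ᵉ_ : ∀ {P Q : ℕ → Set} → Eventually P → Eventually Q → Eventually (λ n → P n × Q n)
(N , P↑) ×ᵉ (N′ , Q↑) = N ⊔ N′ , λ n N⊔N′≤n →
  P↑ n (ℕₚ.≤-trans (ℕₚ.m≤m⊔n N N′) N⊔N′≤n) , Q↑ n (ℕₚ.≤-trans (ℕₚ.m≤n⊔m N N′) N⊔N′≤n)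

eventually⇒∃ : ∀ {P : ℕ → Set} → Eventually P → Σ ℕ P
eventually⇒∃ (N , P↑) = N , P↑ N ℕₚ.≤-refl

eventually-*inv< : ∀ q {c} → 0ℚᵘ < c → Eventually (λ n → q * inv n < c)
eventually-*inv< q {mkℚᵘ +[1+ u ] v} _ = suc (A ℕ.* suc v) , bound
  where
  A = ℤ.∣ ↥ q ∣
  bound : ∀ n → suc (A ℕ.* suc v) ℕ.≤ n → q * inv n < mkℚᵘ +[1+ u ] v
  bound n@(suc _) N≤n = begin-strict
    q * inv n            ≤⟨ *-monoˡ-≤-nonNeg (inv n) {{nonNegative (inv-nonNeg n)}} (q≤∣↥q∣ q) ⟩
    frac A n             <⟨ frac-< {A} {n} {suc u} {suc v} (s≤s z≤n) (s≤s z≤n)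
                                   (ℕₚ.<-≤-trans N≤n (ℕₚ.m≤n*m n (suc u))) ⟩
    frac (suc u) (suc v) ≃⟨ frac-mkℚᵘ (suc u) v ⟩
    mkℚᵘ +[1+ u ] v      ∎
    where open ≤-Reasoning
eventually-*inv< q {mkℚᵘ +0       _} c>0 = ⊥-elim (ℤₚ.<-irrefl refl (>0⇒↥>0 c>0))
eventually-*inv< q {mkℚᵘ -[1+ _ ] _} c>0 = ⊥-elim (ℤₚ.<-asym (>0⇒↥>0 c>0) ℤ.-<+)

-- Blow-ups against strong jumps

∈⇒≤maxR : ∀ {r} R → r ∈ R → r ℕ.≤ maxR R
∈⇒≤maxR (s ∷ R) (here refl) = ℕₚ.m≤m⊔n s (maxR R)
∈⇒≤maxR (s ∷ R) (there r∈R) = ℕₚ.≤-trans (∈⇒≤maxR R r∈R) (ℕₚ.m≤n⊔m s (maxR R))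

prodOnℕ≤sum^card : ∀ {m} (f : Subset m) (c : Vec ℕ m) → prodOnℕ f c ℕ.≤ sum c ^ card f
prodOnℕ≤sum^card []            []      = ℕₚ.≤-refl
prodOnℕ≤sum^card (inside ∷ f)  (a ∷ c) =
  ℕₚ.*-mono-≤ (ℕₚ.m≤m+n a (sum c)) (ℕₚ.≤-trans (prodOnℕ≤sum^card f c) (ℕₚ.^-monoˡ-≤ (card f) (ℕₚ.m≤n+m (sum c) a)))
prodOnℕ≤sum^card (outside ∷ f) (a ∷ c) =
  ℕₚ.≤-trans (prodOnℕ≤sum^card f c) (ℕₚ.^-monoˡ-≤ (card f) (ℕₚ.m≤n+m (sum c) a))

blowUpError : ∀ {m} → Hypergraph m → ℚᵘ
blowUpError F = sumEdges F (λ f → ℕ→ℚ (2 ℕ.* card f ! ℕ.* card f ℕ.* card f))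

p≤q+r⇒p+[0-r]≤q : ∀ {p q r} → p ≤ q + r → p + (0ℚᵘ - r) ≤ q
p≤q+r⇒p+[0-r]≤q {p} {q} {r} p≤q+r = begin
  p + (0ℚᵘ - r)            ≤⟨ +-monoˡ-≤ (0ℚᵘ - r) p≤q+r ⟩
  q + r + (0ℚᵘ - r)        ≃⟨ +-congʳ (q + r) (+-identityˡ (- r)) ⟩
  q + r + - r              ≃⟨ +-assoc q r (- r) ⟩
  q + (r + - r)            ≃⟨ +-congʳ q (+-inverseʳ r) ⟩
  q + 0ℚᵘ                  ≃⟨ +-identityʳ q ⟩
  q                        ∎
  where open ≤-Reasoning

LagPlusLe-mono : ∀ {m} (F : Hypergraph m) {r r′ q} → r′ ≤ r → LagPlusLe F r q → LagPlusLe F r′ q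
LagPlusLe-mono F r′≤r F+r≤q x x∈ = ≤-trans (+-monoʳ-≤ (lagPoly F x) r′≤r) (F+r≤q x x∈)

module _ {m} (R : List ℕ) (F : Hypergraph m) (F-R : IsRGraph R F) where

  private
    M = maxR R

    edge≤M : ∀ f → T (F f) → card f ℕ.≤ M
    edge≤M f f∈F = ∈⇒≤maxR R (F-R f f∈F)

  lagPoly-gridPoint≤h-blowUp : ∀ k → 1 ℕ.≤ sum k → M ℕ.≤ sum k →
    lagPoly F (gridPoint k (sum k)) ≤ h (sum k) (blowUp F (labelling k))
  lagPoly-gridPoint≤h-blowUp k 1≤n M≤n = ≤-trans (sumEdges-mono F edgewise) (≤-reflexive (≃-sym (begin
    h n (blowUp F (labelling k))
      ≡⟨ sym (sumEdges-edgeIn-⊤ (blowUp F (labelling k)) _) ⟩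
    sumEdges (edgeIn (blowUp F (labelling k)) ⊤) (λ e → inv (n C card e))
      ≈⟨ sumEdges-edgeIn-blowUp F (labelling k) ⊤ (λ r → inv (n C r)) ⟩
    sumEdges F (λ f → inv (n C card f) * ℕ→ℚ (prodOnℕ f (profile (labelling k) ⊤)))
      ≡⟨ cong (λ c → sumEdges F (λ f → inv (n C card f) * ℕ→ℚ (prodOnℕ f c))) (profile-labelling k) ⟩
    sumEdges F (λ f → inv (n C card f) * ℕ→ℚ (prodOnℕ f k)) ∎)))
    where
    open ≃-Reasoning
    n = sum k
    edgewise : ∀ f → T (F f) → ℕ→ℚ (card f !) * prodOn f (gridPoint k n) ≤ inv (n C card f) * ℕ→ℚ (prodOnℕ f k)
    edgewise f f∈F = ≤-respˡ-≃ (*-congˡ {ℕ→ℚ (card f !)} (≃-sym (prodOn-gridPoint f k 1≤n)))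
                               (k!*[p/n^k]≤[1/nCk]*p (prodOnℕ f k) 1≤n (ℕₚ.≤-trans (edge≤M f f∈F) M≤n))

  hSub-blowUp≤lagPoly-gridPoint : ∀ {n} (π : Vec (Fin m) n) S {t} → card S ≡ t → 1 ℕ.≤ t → M ℕ.≤ t →
    2 ℕ.* M ℕ.* M ℕ.≤ t → hSub t (blowUp F π) S ≤ lagPoly F (gridPoint (profile π S) t) + blowUpError F * inv t
  hSub-blowUp≤lagPoly-gridPoint π S {t} |S|≡t 1≤t M≤t 2M²≤t =
    ≤-respˡ-≃ (≃-sym (sumEdges-edgeIn-blowUp F π S (λ r → inv (t C r))))
      (≤-trans (sumEdges-mono F edgewise)
               (≤-reflexive (sumEdges-+-*ʳ F _ (λ f → ℕ→ℚ (2 ℕ.* card f ! ℕ.* card f ℕ.* card f)) (inv t))))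
    where
    s = profile π S
    Σs≡t : sum s ≡ t
    Σs≡t = trans (sum-profile π S) |S|≡t
    edgewise : ∀ f → T (F f) → inv (t C card f) * ℕ→ℚ (prodOnℕ f s) ≤
      ℕ→ℚ (card f !) * prodOn f (gridPoint s t) + ℕ→ℚ (2 ℕ.* card f ! ℕ.* card f ℕ.* card f) * inv t
    edgewise f f∈F =
      ≤-respʳ-≃ (+-congˡ (frac (2 ℕ.* card f ! ℕ.* card f ℕ.* card f) t)
                         (*-congˡ {ℕ→ℚ (card f !)} (≃-sym (prodOn-gridPoint f s 1≤t))))
        ([1/nCk]*p≤k!*[p/n^k]+2k!k²/n 1≤t (ℕₚ.≤-trans r≤M M≤t)
          (ℕₚ.≤-trans (ℕₚ.*-mono-≤ (ℕₚ.*-monoʳ-≤ 2 r≤M) r≤M) 2M²≤t)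
          (subst (λ n → prodOnℕ f s ℕ.≤ n ^ card f) Σs≡t (prodOnℕ≤sum^card f s)))
      where
      r≤M = edge≤M f f∈F

  blowUp-noDenseSub : ∀ {n c t} (π : Vec (Fin m) n) → 1 ℕ.≤ t → M ℕ.≤ t → 2 ℕ.* M ℕ.* M ℕ.≤ t →
    blowUpError F * inv t < c → ¬ HasDenseSub F c t (blowUp F π)
  blowUp-noDenseSub {c = c} {t} π 1≤t M≤t 2M²≤t E/t<c (S , |S|≡t , dense) = <-irrefl ≃-refl (begin-strict
    lagPoly F x + c                  ≤⟨ dense x (gridPoint-InSimplex s 1≤t (trans (sum-profile π S) |S|≡t)) ⟩
    hSub t (blowUp F π) S            ≤⟨ hSub-blowUp≤lagPoly-gridPoint π S |S|≡t 1≤t M≤t 2M²≤t ⟩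
    lagPoly F x + blowUpError F * inv t <⟨ +-monoʳ-< (lagPoly F x) E/t<c ⟩
    lagPoly F x + c                  ∎)
    where
    open ≤-Reasoning
    s = profile π S
    x = gridPoint s t

blowUp-dense : ∀ {m} R (F : Hypergraph (suc m)) → IsRGraph R F → ∀ {n} → 1 ℕ.≤ n → maxR R ℕ.≤ n →
  Σ (Vec (Fin (suc m)) n) λ π → LagPlusLe F (0ℚᵘ - lipschitzConstant F * inv n) (h n (blowUp F π))
blowUp-dense {m} R F F-R {n} 1≤n M≤n with argmax-compositions m n (λ k → lagPoly F (gridPoint k n))
... | k , refl , k-max = labelling k , λ x x∈ → p≤q+r⇒p+[0-r]≤q (F-x≤h x x∈)
  where
  L = lipschitzConstant F
  F-x≤h : ∀ x → InSimplex x → lagPoly F x ≤ h (sum k) (blowUp F (labelling k)) + L * inv (sum k)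
  F-x≤h x x∈ with roundToGrid x x∈ 1≤n
  ... | kₓ , Σkₓ≡n , x≤kₓ/n+1/n = begin
    lagPoly F x
      ≤⟨ lagPoly-lipschitz F (inv (sum k)) (InSimplex⇒InUnitCube x∈)
           (InSimplex⇒InUnitCube (gridPoint-InSimplex kₓ 1≤n Σkₓ≡n)) (inv-nonNeg (sum k)) x≤kₓ/n+1/n ⟩
    lagPoly F (gridPoint kₓ (sum k)) + L * inv (sum k)
      ≤⟨ +-monoˡ-≤ (L * inv (sum k)) (k-max kₓ Σkₓ≡n) ⟩
    lagPoly F (gridPoint k (sum k)) + L * inv (sum k)
      ≤⟨ +-monoˡ-≤ (L * inv (sum k)) (lagPoly-gridPoint≤h-blowUp R F F-R k 1≤n M≤n) ⟩
    h (sum k) (blowUp F (labelling k)) + L * inv (sum k) ∎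
    where open ≤-Reasoning

¬IsStrongJump : ∀ {m} R (F : Hypergraph (suc m)) → IsRGraph R F → ¬ IsStrongJump R F
¬IsStrongJump R F F-R (c , c>0 , strong) =
  let M = maxR R
      t , 1≤t , M≤t , 2M²≤t , E/t<c = eventually⇒∃
        (eventually-≥ 1 ×ᵉ eventually-≥ M ×ᵉ eventually-≥ (2 ℕ.* M ℕ.* M) ×ᵉ eventually-*inv< (blowUpError F) c>0)
      n , dense⇒sub , 1≤n , M≤n , L/n<c = eventually⇒∃
        (strong t M≤t ×ᵉ eventually-≥ 1 ×ᵉ eventually-≥ M ×ᵉ eventually-*inv< (lipschitzConstant F) c>0)
      π , G-dense = blowUp-dense R F F-R 1≤n M≤n
  in blowUp-noDenseSub R F F-R π 1≤t M≤t 2M²≤t E/t<c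
       (dense⇒sub (blowUp F π) (blowUp-isRGraph R F π F-R)
         (LagPlusLe-mono F (+-monoʳ-≤ 0ℚᵘ (neg-mono-≤ (<⇒≤ L/n<c))) G-dense))

proposition5 : (R : List ℕ) → All (1 ℕ.≤_) R →
    (m : ℕ) → 1 ℕ.≤ m → (F : Hypergraph m) → IsRGraph R F →
    IsJump R F → IsWeakJump R F
proposition5 R _ (suc m) _ F F-R jump = jump , ¬IsStrongJump R F F-R
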